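{- Let $m,s\in\mathbb{N}$ and $N=(m+2)\binom{s}{2}+1$. For a prime $p$ and $i\in\{0,\ldots,p-1\}$, let $A_{p,i}$ be a deterministic finite automaton over $\{0,1\}$ with $p$ states and a unique accepting state that accepts exactly those strings $w\in\{0,1\}^*$ with $n_w\equiv i \pmod p$. Let $\mathcal{A}$ be the family of all $A_{p,i}$, where $p$ ranges over the first $N$ primes and $i\in\{0,\ldots,p-1\}$. Then $\mathcal{A}$ is an $(m,s)$-isolating family: for every set $W$ of $s$ binary strings, each of length at most $m$, there exist $w\in W$ and $A\in\mathcal{A}$ such that $A$ accepts $w$ and rejects every $w'\in W\setminus\{w\}$.
   Context: For $w\in\{0,1\}^*$, $n_w$ denotes the positive integer whose binary numeral is $1w$ (the string $w$ preceded by a $1$). -}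

module Defs where

open import Data.Nat using (ℕ; zero; suc; _+_; _*_; _<_; _≤_)
open import Data.Nat.Combinatorics using (_C_)
open import Data.Nat.Primality using (Prime; prime?)
open import Data.Bool using (Bool; true; false)
open import Data.Fin using (Fin)
open import Data.List using (List; []; _∷_; length; filter; upTo; foldl)
open import Data.List.Membership.Propositional using (_∈_)
open import Data.List.Relation.Unary.All using (All)
open import Data.List.Relation.Unary.Unique.Propositional using (Unique)
open import Data.Product using (Σ; _×_; ∃; ∃-syntax)
open import Relation.Binary.PropositionalEquality using (_≡_; _≢_)
open import Relation.Nullary using (¬_)

-- binary strings, bits read left to right; true = 1, false = 0
Word : Set
Word = List Bool

bit : Bool → ℕ
bit true  = 1
bit false = 0

-- n_w : the number whose binary numeral (most significant bit first) is 1w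
nval : Word → ℕ
nval w = foldl (λ acc b → 2 * acc + bit b) 1 w

record DFA (k : ℕ) : Set where
  field
    start  : Fin k
    δ      : Fin k → Bool → Fin k
    final  : Fin k

run : ∀ {k} → DFA k → Fin k → Word → Fin k
run M q []       = q
run M q (b ∷ w)  = run M (DFA.δ M q b) w

Accepts : ∀ {k} → DFA k → Word → Set
Accepts M w = run M (DFA.start M) w ≡ DFA.final M

primesBelow : ℕ → ℕ
primesBelow p = length (filter prime? (upTo p))

AmongFirstPrimes : ℕ → ℕ → Set
AmongFirstPrimes N p = Prime p × primesBelow p < N

bigN : ℕ → ℕ → ℕ
bigN m s = (m + 2) * (s C 2) + 1

Isolating : ℕ → ℕ → (ℕ → Set) → ((p : ℕ) → Fin p → DFA p) → Set
Isolating m s InFam A =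
  (W : List Word) → Unique W → length W ≡ s → All (λ w → length w ≤ m) W →
  ∃[ w ] (w ∈ W × ∃[ p ] Σ (Fin p) λ i →
    InFam p × Accepts (A p i) w ×
    ((w′ : Word) → w′ ∈ W → w′ ≢ w → ¬ Accepts (A p i) w′))

-- Isolate the first word w of W. The distances ∣ n_w - n_v ∣ to the other words v are nonzero
-- (n is injective) and below 2^(m+1), so their product D satisfies 0 < D ≤ 2^((m+1)(s-1)).
-- Let p be the least prime not dividing D. The π(p) primes below p all divide D, so
-- 2^π(p) ≤ D and π(p) ≤ (m+1)(s-1) < N. Then A_{p, n_w mod p} accepts w, and accepting
-- another v would give p ∣ ∣ n_w - n_v ∣ ∣ D.
module Submission where

open import Defs
open import Data.Nat
open import Data.Nat.Properties
open import Data.Nat.Divisibility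
open import Data.Nat.DivMod
open import Data.Nat.Primality
open import Data.Nat.Primality.Factorisation using (factorise; PrimeFactorisation)
open import Data.Nat.ListAction using (product)
open import Data.Nat.Combinatorics using (_C_; nCk+nC[k+1]≡[n+1]C[k+1]; nC1≡n)
open import Data.Bool using (true; false)
open import Data.Fin using (Fin; toℕ; fromℕ<)
open import Data.Fin.Properties using (toℕ-fromℕ<)
open import Data.List using (List; []; _∷_; length; foldr; reverse; filter; upTo; [_]; _++_)
open import Data.List.Properties
  using (foldr-ʳ++; reverse-injective; length-reverse; applyUpTo-∷ʳ; length-++; filter-++; filter-accept; filter-reject)
open import Data.List.Relation.Unary.All using (All; _∷_; [])
open import Data.List.Relation.Unary.Any using (here; there)
open import Data.List.Relation.Unary.AllPairs using (_∷_)
open import Data.List.Membership.Propositional using (_∈_)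
open import Data.Product using (_×_; _,_; ∃-syntax)
open import Data.Sum using (_⊎_; inj₁; inj₂)
open import Relation.Binary.PropositionalEquality
  using (_≡_; _≢_; refl; sym; trans; cong; cong₂; subst; module ≡-Reasoning)
open import Relation.Nullary using (¬_; yes; no; contradiction)
open import Function using (_∘_; id)
open import Function.Bundles using (_⇔_; Equivalence)

nvalʳ : Word → ℕ
nvalʳ = foldr (λ b acc → 2 * acc + bit b) 1

nval≡nvalʳ∘reverse : ∀ w → nval w ≡ nvalʳ (reverse w)
nval≡nvalʳ∘reverse w = sym (foldr-ʳ++ (λ b acc → 2 * acc + bit b) 1 w {[]})

nvalʳ>0 : ∀ r → 0 < nvalʳ r
nvalʳ>0 []      = z<s
nvalʳ>0 (b ∷ r) = ≤-trans (nvalʳ>0 r) (≤-trans (m≤m+n _ _) (m≤m+n _ (bit b)))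

2*+bit-injective : ∀ b c x y → 2 * x + bit b ≡ 2 * y + bit c → b ≡ c × x ≡ y
2*+bit-injective true  true  x y eq = refl , *-cancelˡ-≡ x y 2 (+-cancelʳ-≡ 1 _ _ eq)
2*+bit-injective false false x y eq = refl , *-cancelˡ-≡ x y 2 (+-cancelʳ-≡ 0 _ _ eq)
2*+bit-injective false true  x y eq = contradiction (trans (sym (+-identityʳ _)) (trans eq (+-comm _ 1))) (even≢odd x y)
2*+bit-injective true  false x y eq = contradiction (trans (sym (+-identityʳ _)) (trans (sym eq) (+-comm _ 1))) (even≢odd y x)

1<nvalʳ-∷ : ∀ b r → 1 < nvalʳ (b ∷ r)
1<nvalʳ-∷ b r = ≤-trans (*-monoʳ-≤ 2 (nvalʳ>0 r)) (m≤m+n _ (bit b))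

nvalʳ-injective : ∀ r r′ → nvalʳ r ≡ nvalʳ r′ → r ≡ r′
nvalʳ-injective []      []        _  = refl
nvalʳ-injective []      (c ∷ r′)  eq = contradiction eq (<⇒≢ (1<nvalʳ-∷ c r′))
nvalʳ-injective (b ∷ r) []        eq = contradiction (sym eq) (<⇒≢ (1<nvalʳ-∷ b r))
nvalʳ-injective (b ∷ r) (c ∷ r′)  eq with 2*+bit-injective b c (nvalʳ r) (nvalʳ r′) eq
... | refl , eq′ = cong (b ∷_) (nvalʳ-injective r r′ eq′)

nval-injective : ∀ u v → nval u ≡ nval v → u ≡ v
nval-injective u v eq = reverse-injective (nvalʳ-injective (reverse u) (reverse v)
  (trans (sym (nval≡nvalʳ∘reverse u)) (trans eq (nval≡nvalʳ∘reverse v))))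

bit≤1 : ∀ b → bit b ≤ 1
bit≤1 true  = ≤-refl
bit≤1 false = z≤n

nvalʳ<2^ : ∀ r → nvalʳ r < 2 ^ suc (length r)
nvalʳ<2^ []      = s≤s (s≤s z≤n)
nvalʳ<2^ (b ∷ r) = begin-strict
  2 * x + bit b           <⟨ +-monoʳ-< (2 * x) (s≤s (bit≤1 b)) ⟩
  2 * x + 2               ≡⟨ trans (+-comm (2 * x) 2) (sym (*-suc 2 x)) ⟩
  2 * suc x               ≤⟨ *-monoʳ-≤ 2 (nvalʳ<2^ r) ⟩
  2 * 2 ^ suc (length r)  ∎
  where
  open ≤-Reasoning
  x = nvalʳ r

nval<2^ : ∀ {m} w → length w ≤ m → nval w < 2 ^ suc m
nval<2^ {m} w |w|≤m = begin-strict
  nval w                          ≡⟨ nval≡nvalʳ∘reverse w ⟩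
  nvalʳ (reverse w)               <⟨ nvalʳ<2^ (reverse w) ⟩
  2 ^ suc (length (reverse w))    ≤⟨ ^-monoʳ-≤ 2 (s≤s (subst (_≤ m) (sym (length-reverse w)) |w|≤m)) ⟩
  2 ^ suc m                       ∎
  where open ≤-Reasoning

%-≡⇒∣∣-∣ : ∀ a b p .{{_ : NonZero p}} → a % p ≡ b % p → p ∣ ∣ a - b ∣
%-≡⇒∣∣-∣ a b p eq = divides ∣ a / p - b / p ∣ (begin
  ∣ a - b ∣                                        ≡⟨ cong₂ ∣_-_∣ (m≡m%n+[m/n]*n a p) (m≡m%n+[m/n]*n b p) ⟩
  ∣ a % p + a / p * p - b % p + b / p * p ∣        ≡⟨ cong (λ r → ∣ a % p + a / p * p - r + b / p * p ∣) (sym eq) ⟩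
  ∣ a % p + a / p * p - a % p + b / p * p ∣        ≡⟨ ∣m+n-m+o∣≡∣n-o∣ (a % p) _ _ ⟩
  ∣ a / p * p - b / p * p ∣                        ≡⟨ sym (*-distribʳ-∣-∣ p (a / p) (b / p)) ⟩
  ∣ a / p - b / p ∣ * p                            ∎)
  where open ≡-Reasoning

prime>1 : ∀ {p} → Prime p → 1 < p
prime>1 {p} pr = nonTrivial⇒n>1 p {{prime⇒nonTrivial pr}}

prime∤prime : ∀ {q p} → Prime q → Prime p → q < p → q ∤ p
prime∤prime pq pp q<p q∣p = Prime.notComposite pp (hasNonTrivialDivisor {{prime⇒nonTrivial pq}} q<p q∣p)

prime∤suc : ∀ {q D} → Prime q → q ∣ suc D → q ∤ D
prime∤suc {q} {D} pq q∣1+D q∣D = <⇒≢ (prime>1 pq) (sym (∣1⇒≡1 (∣m+n∣m⇒∣n (subst (q ∣_) (+-comm 1 D) q∣1+D) q∣D)))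

∃prime∤ : ∀ D → 0 < D → ∃[ q ] (Prime q × q ∤ D)
∃prime∤ D D>0 with PrimeFactorisation.factors f | PrimeFactorisation.isFactorisation f | PrimeFactorisation.factorsPrime f
  where f = factorise (suc D)
... | []     | 1+D≡1 | _        = contradiction (suc-injective 1+D≡1) (>⇒≢ D>0)
... | q ∷ qs | 1+D≡∏ | pq ∷ _   = q , pq , prime∤suc pq (divides (product qs) (trans 1+D≡∏ (*-comm q _)))

primesBelow-suc : ∀ n → primesBelow (suc n) ≡ primesBelow n + length (filter prime? [ n ])
primesBelow-suc n = begin
  length (filter prime? (upTo (suc n)))                 ≡⟨ cong (length ∘ filter prime?) (sym (applyUpTo-∷ʳ id n)) ⟩
  length (filter prime? (upTo n ++ [ n ]))              ≡⟨ cong length (filter-++ prime? (upTo n) [ n ]) ⟩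
  length (filter prime? (upTo n) ++ filter prime? [ n ]) ≡⟨ length-++ (filter prime? (upTo n)) ⟩
  primesBelow n + length (filter prime? [ n ])          ∎
  where open ≡-Reasoning

primesBelow-suc-prime : ∀ {n} → Prime n → primesBelow (suc n) ≡ suc (primesBelow n)
primesBelow-suc-prime {n} pn = trans (primesBelow-suc n)
  (trans (cong (λ l → primesBelow n + length l) (filter-accept prime? pn)) (+-comm _ 1))

primesBelow-suc-¬prime : ∀ {n} → ¬ Prime n → primesBelow (suc n) ≡ primesBelow n
primesBelow-suc-¬prime {n} ¬pn = trans (primesBelow-suc n)
  (trans (cong (λ l → primesBelow n + length l) (filter-reject prime? ¬pn)) (+-identityʳ _))

PrimesBelowDivide : ℕ → ℕ → Set
PrimesBelowDivide n D = ∀ {q} → q < n → Prime q → q ∣ D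

2^primesBelow≤ : ∀ n {D} → 0 < D → PrimesBelowDivide n D → 2 ^ primesBelow n ≤ D
2^primesBelow≤ zero    D>0 _   = D>0
2^primesBelow≤ (suc n) D>0 below with prime? n
... | no ¬pn rewrite primesBelow-suc-¬prime ¬pn = 2^primesBelow≤ n D>0 (below ∘ m<n⇒m<1+n)
... | yes pn with below (n<1+n n) pn
...   | divides k refl rewrite primesBelow-suc-prime pn =
  ≤-trans (*-mono-≤ (prime>1 pn) (2^primesBelow≤ n k>0 below-k)) (≤-reflexive (*-comm n k))
  where
  k>0 : 0 < k
  k>0 = n≢0⇒n>0 (λ { refl → <⇒≢ D>0 refl })
  below-k : PrimesBelowDivide n k
  below-k q<n pq with euclidsLemma k n pq (below (m<n⇒m<1+n q<n) pq)
  ... | inj₁ q∣k = q∣k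
  ... | inj₂ q∣n = contradiction q∣n (prime∤prime pq pn q<n)

primesBelowDivide-suc : ∀ {n D} → PrimesBelowDivide n D → (Prime n → n ∣ D) → PrimesBelowDivide (suc n) D
primesBelowDivide-suc below at-n q<1+n pq with m<1+n⇒m<n∨m≡n q<1+n
... | inj₁ q<n  = below q<n pq
... | inj₂ refl = at-n pq

least-prime∤ : ∀ n D → PrimesBelowDivide n D ⊎ ∃[ p ] (Prime p × p ∤ D × PrimesBelowDivide p D)
least-prime∤ zero    D = inj₁ λ ()
least-prime∤ (suc n) D with least-prime∤ n D
... | inj₂ found = inj₂ found
... | inj₁ below with prime? n | n ∣? D
...   | yes pn | no n∤D  = inj₂ (n , pn , n∤D , below)
...   | yes pn | yes n∣D = inj₁ (primesBelowDivide-suc below λ _ → n∣D)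
...   | no ¬pn | _       = inj₁ (primesBelowDivide-suc below λ pn → contradiction pn ¬pn)

∃least-prime∤ : ∀ {D} → 0 < D → ∃[ p ] (Prime p × p ∤ D × PrimesBelowDivide p D)
∃least-prime∤ {D} D>0 with ∃prime∤ D D>0
... | q , pq , q∤D with least-prime∤ (suc q) D
...   | inj₁ below = contradiction (below (n<1+n q) pq) q∤D
...   | inj₂ found = found

primesBelow≤ : ∀ {p D k} → 0 < D → PrimesBelowDivide p D → D ≤ 2 ^ k → primesBelow p ≤ k
primesBelow≤ {p} D>0 below D≤2^k = ≮⇒≥ λ k<π →
  <⇒≱ (^-monoʳ-< 2 (n<1+n 1) k<π) (≤-trans (2^primesBelow≤ p D>0 below) D≤2^k)

distanceProduct : ℕ → List Word → ℕ
distanceProduct a []       = 1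
distanceProduct a (v ∷ vs) = ∣ a - nval v ∣ * distanceProduct a vs

∣-distanceProduct : ∀ a {v vs} → v ∈ vs → ∣ a - nval v ∣ ∣ distanceProduct a vs
∣-distanceProduct a {vs = u ∷ vs} (here refl) = m∣m*n (distanceProduct a vs)
∣-distanceProduct a {vs = u ∷ vs} (there v∈vs) = ∣-trans (∣-distanceProduct a v∈vs) (n∣m*n ∣ a - nval u ∣)

distanceProduct>0 : ∀ w vs → All (w ≢_) vs → 0 < distanceProduct (nval w) vs
distanceProduct>0 w []       []            = z<s
distanceProduct>0 w (v ∷ vs) (w≢v ∷ w≢vs) = *-mono-≤ distance>0 (distanceProduct>0 w vs w≢vs)
  where
  distance>0 : 0 < ∣ nval w - nval v ∣
  distance>0 = n≢0⇒n>0 (w≢v ∘ nval-injective w v ∘ ∣m-n∣≡0⇒m≡n)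

distanceProduct≤2^ : ∀ {m} w vs → length w ≤ m → All (λ v → length v ≤ m) vs →
                     distanceProduct (nval w) vs ≤ 2 ^ (suc m * length vs)
distanceProduct≤2^ {m} w [] _ [] = ≤-reflexive (cong (2 ^_) (sym (*-zeroʳ m)))
distanceProduct≤2^ {m} w (v ∷ vs) |w|≤m (|v|≤m ∷ |vs|≤m) = begin
  ∣ nval w - nval v ∣ * distanceProduct (nval w) vs  ≤⟨ *-mono-≤ distance≤ (distanceProduct≤2^ w vs |w|≤m |vs|≤m) ⟩
  2 ^ suc m * 2 ^ (suc m * length vs)                ≡⟨ sym (^-distribˡ-+-* 2 (suc m) _) ⟩
  2 ^ (suc m + suc m * length vs)                    ≡⟨ cong (2 ^_) (sym (*-suc (suc m) (length vs))) ⟩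
  2 ^ (suc m * suc (length vs))                      ∎
  where
  open ≤-Reasoning
  distance≤ : ∣ nval w - nval v ∣ ≤ 2 ^ suc m
  distance≤ = ≤-trans (∣m-n∣≤m⊔n (nval w) (nval v)) (⊔-lub (<⇒≤ (nval<2^ w |w|≤m)) (<⇒≤ (nval<2^ v |v|≤m)))

[1+m]*t<bigN : ∀ m t → suc m * t < bigN m (suc t)
[1+m]*t<bigN m t = begin-strict
  suc m * t              ≤⟨ *-mono-≤ (n≤1+n (suc m)) t≤[1+t]C2 ⟩
  (2 + m) * (suc t C 2)  ≡⟨ cong (_* (suc t C 2)) (+-comm 2 m) ⟩
  (m + 2) * (suc t C 2)  <⟨ n<1+n _ ⟩
  suc ((m + 2) * (suc t C 2))  ≡⟨ +-comm 1 _ ⟩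
  bigN m (suc t)         ∎
  where
  open ≤-Reasoning
  t≤[1+t]C2 : t ≤ suc t C 2
  t≤[1+t]C2 = begin
    t                ≡⟨ nC1≡n t ⟨
    t C 1            ≤⟨ m≤m+n (t C 1) (t C 2) ⟩
    t C 1 + t C 2    ≡⟨ nCk+nC[k+1]≡[n+1]C[k+1] t 1 ⟩
    suc t C 2        ∎

ResidueAutomata : ((p : ℕ) → Fin p → DFA p) → Set
ResidueAutomata A = (p : ℕ) (pr : Prime p) (i : Fin p) (w : Word) →
  Accepts (A p i) w ⇔ (_%_ (nval w) p {{prime⇒nonZero pr}} ≡ toℕ i)

Isolates : ((p : ℕ) → Fin p → DFA p) → List Word → Word → (p : ℕ) → Fin p → Set
Isolates A W w p i = Accepts (A p i) w × ((w′ : Word) → w′ ∈ W → w′ ≢ w → ¬ Accepts (A p i) w′)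

residue : ∀ {p} → Prime p → ℕ → Fin p
residue {p} pp a = fromℕ< (m%n<n a p {{prime⇒nonZero pp}})

isolates-by-prime∤ : ∀ {A w rest p} → ResidueAutomata A → (pp : Prime p) →
                     p ∤ distanceProduct (nval w) rest → Isolates A (w ∷ rest) w p (residue pp (nval w))
isolates-by-prime∤ {A} {w} {rest} {p} residues pp p∤D = accepts-w , rejects-rest
  where
  instance
    _ : NonZero p
    _ = prime⇒nonZero pp
  accepts : ∀ v → Accepts (A p (residue pp (nval w))) v ⇔ (nval v % p ≡ nval w % p)
  accepts v = subst (λ r → Accepts (A p (residue pp (nval w))) v ⇔ (nval v % p ≡ r))
                    (toℕ-fromℕ< (m%n<n (nval w) p)) (residues p pp (residue pp (nval w)) v)
  accepts-w : Accepts (A p (residue pp (nval w))) w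
  accepts-w = Equivalence.from (accepts w) refl
  rejects-rest : (w′ : Word) → w′ ∈ w ∷ rest → w′ ≢ w → ¬ Accepts (A p (residue pp (nval w))) w′
  rejects-rest w′ (here w′≡w)   w′≢w _  = w′≢w w′≡w
  rejects-rest w′ (there w′∈rest) _ acc = p∤D (∣-trans
    (%-≡⇒∣∣-∣ (nval w) (nval w′) p (sym (Equivalence.to (accepts w′) acc)))
    (∣-distanceProduct (nval w) w′∈rest))

lemma1 : (m s : ℕ) → 1 ≤ s →
    (A : (p : ℕ) → Fin p → DFA p) →
    ((p : ℕ) (pr : Prime p) (i : Fin p) (w : Word) →
      Accepts (A p i) w ⇔ (_%_ (nval w) p {{prime⇒nonZero pr}} ≡ toℕ i)) →
    Isolating m s (AmongFirstPrimes (bigN m s)) A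
lemma1 m .(suc (length rest)) (s≤s z≤n) A residues (w ∷ rest) (w∉rest ∷ _) refl (|w|≤m ∷ |rest|≤m)
  with ∃least-prime∤ (distanceProduct>0 w rest w∉rest)
... | p , pp , p∤D , below =
  w , here refl , p , residue pp (nval w) , (pp , π[p]<N) , isolates-by-prime∤ residues pp p∤D
  where
  π[p]<N : primesBelow p < bigN m (suc (length rest))
  π[p]<N = ≤-<-trans
    (primesBelow≤ (distanceProduct>0 w rest w∉rest) below (distanceProduct≤2^ w rest |w|≤m |rest|≤m))
    ([1+m]*t<bigN m (length rest))
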